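{- Let $p$ be a prime and $H\subseteq\mathrm{GL}_2(\mathbb{Z}_p)$ a closed subgroup. If $\langle H,-1\rangle\supseteq 1+p^n\mathrm{M}_2(\mathbb{Z}_p)$ for some integer $n\geq 1$, then $H\supseteq 1+p^n\mathrm{M}_2(\mathbb{Z}_p)$ if $p\geq 3$, and $H\supseteq 1+p^{n+1}\mathrm{M}_2(\mathbb{Z}_p)$ if $p=2$ and $n\geq 2$.
   Context: $\langle H,-1\rangle$ denotes the subgroup of $\mathrm{GL}_2(\mathbb{Z}_p)$ generated by $H$ and $-1$ (minus the identity matrix). -}

module Defs where

open import Level using (0ℓ)
open import Data.Nat using (ℕ; zero; suc) renaming (_^_ to _^ℕ_)
open import Data.Integer using (ℤ; +_; _+_; _-_; _*_; -_; 0ℤ; 1ℤ)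
open import Data.Integer.Properties using (+-inverseʳ)
open import Data.Integer.Divisibility.Signed using (_∣_; divides; ∣-reflexive; ∣m∣n⇒∣m+n; ∣m⇒∣-m; ∣n⇒∣m*n; ∣m⇒∣m*n)
open import Data.Integer.Solver using (module +-*-Solver)
open import Data.Product using (Σ; _×_; _,_)
open import Relation.Binary.PropositionalEquality using (_≡_; refl; sym; subst)

-- The p-adic integers ℤ_p, as the inverse limit lim ℤ/p^k:
-- a coherent sequence of integers (x_k) with x_{k+1} ≡ x_k (mod p^k),
-- two such being equal when x_k ≡ y_k (mod p^k) for every k.

record ℤp (p : ℕ) : Set where
  constructor mkℤp
  field
    seq : ℕ → ℤ
    coh : ∀ k → (+ (p ^ℕ k)) ∣ (seq (suc k) - seq k)
open ℤp public

module _ {p : ℕ} where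

  infix 4 _≈p_
  _≈p_ : ℤp p → ℤp p → Set
  x ≈p y = ∀ k → (+ (p ^ℕ k)) ∣ (seq x k - seq y k)

  private
    0∣ : ∀ {m : ℤ} → m ∣ 0ℤ
    0∣ {m} = divides 0ℤ refl

    mulId : ∀ a a' b b' → a' * b' - a * b ≡ a' * (b' - b) + (a' - a) * b
    mulId = +-*-Solver.solve 4
      (λ a a' b b' → a' :* b' :- a :* b := a' :* (b' :- b) :+ (a' :- a) :* b) refl
      where open +-*-Solver

    addId : ∀ a a' b b' → (a' + b') - (a + b) ≡ (a' - a) + (b' - b)
    addId = +-*-Solver.solve 4
      (λ a a' b b' → (a' :+ b') :- (a :+ b) := (a' :- a) :+ (b' :- b)) refl
      where open +-*-Solver

    negId : ∀ a a' → (- a') - (- a) ≡ - (a' - a)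
    negId = +-*-Solver.solve 2 (λ a a' → (:- a') :- (:- a) := :- (a' :- a)) refl
      where open +-*-Solver

  ι : ℤ → ℤp p
  ι z = mkℤp (λ _ → z) (λ k → subst (λ w → _ ∣ w) (sym (+-inverseʳ z)) 0∣)

  infixl 6 _+p_
  _+p_ : ℤp p → ℤp p → ℤp p
  x +p y = mkℤp (λ k → seq x k + seq y k)
    (λ k → subst (λ w → _ ∣ w) (sym (addId (seq x k) (seq x (suc k)) (seq y k) (seq y (suc k))))
             (∣m∣n⇒∣m+n (coh x k) (coh y k)))

  -p_ : ℤp p → ℤp p
  -p x = mkℤp (λ k → - seq x k)
    (λ k → subst (λ w → _ ∣ w) (sym (negId (seq x k) (seq x (suc k)))) (∣m⇒∣-m (coh x k)))

  infixl 7 _*p_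
  _*p_ : ℤp p → ℤp p → ℤp p
  x *p y = mkℤp (λ k → seq x k * seq y k)
    (λ k → subst (λ w → _ ∣ w) (sym (mulId (seq x k) (seq x (suc k)) (seq y k) (seq y (suc k))))
             (∣m∣n⇒∣m+n (∣n⇒∣m*n (seq x (suc k)) (coh y k)) (∣m⇒∣m*n (seq y k) (coh x k))))

record M₂ (p : ℕ) : Set where
  constructor mat
  field
    e₁₁ e₁₂ e₂₁ e₂₂ : ℤp p
open M₂ public

module _ {p : ℕ} where

  infix 4 _≈_
  _≈_ : M₂ p → M₂ p → Set
  A ≈ B = (e₁₁ A ≈p e₁₁ B) × (e₁₂ A ≈p e₁₂ B) × (e₂₁ A ≈p e₂₁ B) × (e₂₂ A ≈p e₂₂ B)

  infixl 7 _·_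
  _·_ : M₂ p → M₂ p → M₂ p
  A · B = mat (e₁₁ A *p e₁₁ B +p e₁₂ A *p e₂₁ B) (e₁₁ A *p e₁₂ B +p e₁₂ A *p e₂₂ B)
              (e₂₁ A *p e₁₁ B +p e₂₂ A *p e₂₁ B) (e₂₁ A *p e₁₂ B +p e₂₂ A *p e₂₂ B)

  infixl 6 _⊕_
  _⊕_ : M₂ p → M₂ p → M₂ p
  A ⊕ B = mat (e₁₁ A +p e₁₁ B) (e₁₂ A +p e₁₂ B) (e₂₁ A +p e₂₁ B) (e₂₂ A +p e₂₂ B)

  infixl 7 _⋆_
  _⋆_ : ℤp p → M₂ p → M₂ p
  c ⋆ A = mat (c *p e₁₁ A) (c *p e₁₂ A) (c *p e₂₁ A) (c *p e₂₂ A)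

  𝟙 : M₂ p
  𝟙 = mat (ι 1ℤ) (ι 0ℤ) (ι 0ℤ) (ι 1ℤ)

  -𝟙 : M₂ p
  -𝟙 = mat (ι (- 1ℤ)) (ι 0ℤ) (ι 0ℤ) (ι (- 1ℤ))

  IsInverse : M₂ p → M₂ p → Set
  IsInverse A B = (A · B ≈ 𝟙) × (B · A ≈ 𝟙)

  InGL₂ : M₂ p → Set
  InGL₂ A = Σ (M₂ p) (IsInverse A)

  Cong : ℕ → M₂ p → Set
  Cong n A = Σ (M₂ p) (λ Y → A ≈ 𝟙 ⊕ ι (+ (p ^ℕ n)) ⋆ Y)

  NearMod : ℕ → M₂ p → M₂ p → Set
  NearMod k A B = Σ (M₂ p) (λ Y → A ≈ B ⊕ ι (+ (p ^ℕ k)) ⋆ Y)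

  record IsSubgroupGL₂ (H : M₂ p → Set) : Set where
    field
      respects : ∀ {A B} → A ≈ B → H A → H B
      inGL     : ∀ {A} → H A → InGL₂ A
      one      : H 𝟙
      mul      : ∀ {A B} → H A → H B → H (A · B)
      inv      : ∀ {A B} → H A → IsInverse A B → H B

  IsClosed : (H : M₂ p → Set) → Set
  IsClosed H = ∀ A → InGL₂ A → (∀ k → Σ (M₂ p) (λ B → H B × NearMod k A B)) → H A

  record IsClosedSubgroupGL₂ (H : M₂ p → Set) : Set where
    field
      subgroup : IsSubgroupGL₂ H
      closed   : IsClosed H

  -- ⟨H, -1⟩: the subgroup of GL₂(ℤ_p) generated by H and -1
  -- (the smallest subset containing H and -1, closed under products,
  -- inverses and equality).
  data Gen (H : M₂ p → Set) : M₂ p → Set where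
    gen-H    : ∀ {A} → H A → Gen H A
    gen-neg  : Gen H -𝟙
    gen-mul  : ∀ {A B} → Gen H A → Gen H B → Gen H (A · B)
    gen-inv  : ∀ {A B} → Gen H A → IsInverse A B → Gen H B
    gen-resp : ∀ {A B} → A ≈ B → Gen H A → Gen H B

module Submission where

-- Since −1 is central of order 2, ⟨H, −1⟩ = H ∪ −H, so every square of an element of ⟨H, −1⟩
-- lies in H. By the binomial formula (1 + cY)² = 1 + 2cY + c²Y², an element 1 + p^m Y is a square
-- modulo p^(m+1) of an element of 1 + p^m M₂(ℤ_p) when p is odd (take c = p^m (p+1)/2), and of
-- 1 + p^(m−1) M₂(ℤ_p) when p = 2 and m ≥ 3 (take c = 2^(m−1)). For m ≥ n, resp. m ≥ n + 1, that
-- element lies in ⟨H, −1⟩, so H meets every coset of 1 + p^(m+1) M₂(ℤ_p) in 1 + p^m M₂(ℤ_p).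
-- Correcting successively, every element of the target congruence subgroup is a p-adic limit of
-- elements of H, hence lies in H because H is closed.

open import Defs
open import Data.Nat using (ℕ; zero; suc; _≤_; s≤s; z≤n; _≤′_; ≤′-refl; ≤′-step; _%_; _/_)
  renaming (_^_ to _^ℕ_; _+_ to _+ℕ_; _*_ to _*ℕ_)
import Data.Nat.Properties as ℕ
open import Data.Nat.DivMod using (m≡m%n+[m/n]*n; m%n<n)
open import Data.Nat.Divisibility using (divides)
open import Data.Nat.Primality using (Prime; composite-≢; prime⇒nonZero)
open import Data.Integer using (ℤ; +_; _+_; _-_; _*_; -_; 0ℤ; 1ℤ)
open import Data.Integer.Properties using (+-inverseʳ; pos-+; pos-*)
open import Data.Integer.Divisibility.Signed using (_∣_; divides; ∣m∣n⇒∣m+n; ∣m⇒∣-m; ∣n⇒∣m*n; ∣m⇒∣m*n)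
open import Data.Integer.Tactic.RingSolver using (solve-∀; solve)
open import Data.List using (_∷_; [])
open import Data.Product using (Σ; _×_; _,_; proj₁; proj₂)
open import Data.Sum using (_⊎_; inj₁; inj₂)
open import Data.Empty using (⊥-elim)
open import Function using (_∘_)
open import Level using (0ℓ)
open import Relation.Binary.Bundles using (Setoid)
open import Relation.Binary.PropositionalEquality using (_≡_; refl; sym; trans; cong; cong₂; subst; module ≡-Reasoning)
import Relation.Binary.Reasoning.Setoid as SetoidReasoning

-- Congruences of integers and of integer matrices

infix 4 _≡_mod_
record _≡_mod_ (i j d : ℤ) : Set where
  constructor mod-intro
  field divides-difference : d ∣ i - j
open _≡_mod_

private
  neg-minus : ∀ i j → - (i - j) ≡ j - i
  neg-minus = solve-∀

  minus-telescope : ∀ i j k → (i - j) + (j - k) ≡ i - k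
  minus-telescope = solve-∀

  minus-+ : ∀ i i' j j' → (i - i') + (j - j') ≡ (i + j) - (i' + j')
  minus-+ = solve-∀

  minus-* : ∀ i i' j j' → i * (j - j') + (i - i') * j' ≡ i * j - i' * j'
  minus-* = solve-∀

module _ {d : ℤ} where

  private
    ∣-resp-≡ : ∀ {i j} → i ≡ j → d ∣ i → d ∣ j
    ∣-resp-≡ = subst (d ∣_)

  ≡mod-refl : ∀ {i} → i ≡ i mod d
  ≡mod-refl {i} = mod-intro (∣-resp-≡ (sym (+-inverseʳ i)) (divides 0ℤ refl))

  ≡mod-sym : ∀ {i j} → i ≡ j mod d → j ≡ i mod d
  ≡mod-sym {i} {j} (mod-intro d∣) = mod-intro (∣-resp-≡ (neg-minus i j) (∣m⇒∣-m d∣))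

  ≡mod-trans : ∀ {i j k} → i ≡ j mod d → j ≡ k mod d → i ≡ k mod d
  ≡mod-trans {i} {j} {k} (mod-intro d∣) (mod-intro d∣') =
    mod-intro (∣-resp-≡ (minus-telescope i j k) (∣m∣n⇒∣m+n d∣ d∣'))

  +-cong-mod : ∀ {i i' j j'} → i ≡ i' mod d → j ≡ j' mod d → i + j ≡ i' + j' mod d
  +-cong-mod {i} {i'} {j} {j'} (mod-intro d∣) (mod-intro d∣') =
    mod-intro (∣-resp-≡ (minus-+ i i' j j') (∣m∣n⇒∣m+n d∣ d∣'))

  *-cong-mod : ∀ {i i' j j'} → i ≡ i' mod d → j ≡ j' mod d → i * j ≡ i' * j' mod d
  *-cong-mod {i} {i'} {j} {j'} (mod-intro d∣) (mod-intro d∣') =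
    mod-intro (∣-resp-≡ (minus-* i i' j j') (∣m∣n⇒∣m+n (∣n⇒∣m*n i d∣') (∣m⇒∣m*n j' d∣)))

data M₂ℤ : Set where
  ⟦_,_,_,_⟧ : ℤ → ℤ → ℤ → ℤ → M₂ℤ

infixl 6 _⊕ᶻ_
infixl 7 _·ᶻ_ _⋆ᶻ_

_·ᶻ_ : M₂ℤ → M₂ℤ → M₂ℤ
⟦ a , b , c , e ⟧ ·ᶻ ⟦ a' , b' , c' , e' ⟧ =
  ⟦ a * a' + b * c' , a * b' + b * e' , c * a' + e * c' , c * b' + e * e' ⟧

_⊕ᶻ_ : M₂ℤ → M₂ℤ → M₂ℤ
⟦ a , b , c , e ⟧ ⊕ᶻ ⟦ a' , b' , c' , e' ⟧ = ⟦ a + a' , b + b' , c + c' , e + e' ⟧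

_⋆ᶻ_ : ℤ → M₂ℤ → M₂ℤ
s ⋆ᶻ ⟦ a , b , c , e ⟧ = ⟦ s * a , s * b , s * c , s * e ⟧

𝟙ᶻ -𝟙ᶻ : M₂ℤ
𝟙ᶻ = ⟦ 1ℤ , 0ℤ , 0ℤ , 1ℤ ⟧
-𝟙ᶻ = ⟦ - 1ℤ , 0ℤ , 0ℤ , - 1ℤ ⟧

infix 4 _≡ᴹ_mod_
data _≡ᴹ_mod_ : M₂ℤ → M₂ℤ → ℤ → Set where
  entrywise : ∀ {a b c e a' b' c' e' d} → a ≡ a' mod d → b ≡ b' mod d → c ≡ c' mod d → e ≡ e' mod d →
              ⟦ a , b , c , e ⟧ ≡ᴹ ⟦ a' , b' , c' , e' ⟧ mod d

entries : ∀ {a b c e a' b' c' e' d} → ⟦ a , b , c , e ⟧ ≡ᴹ ⟦ a' , b' , c' , e' ⟧ mod d →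
          (d ∣ a - a') × (d ∣ b - b') × (d ∣ c - c') × (d ∣ e - e')
entries (entrywise a b c e) =
  divides-difference a , divides-difference b , divides-difference c , divides-difference e

module _ {d : ℤ} where

  ≡⇒≡ᴹmod : ∀ {M N} → M ≡ N → M ≡ᴹ N mod d
  ≡⇒≡ᴹmod {⟦ _ , _ , _ , _ ⟧} refl = entrywise ≡mod-refl ≡mod-refl ≡mod-refl ≡mod-refl

  ≡ᴹmod-sym : ∀ {M N} → M ≡ᴹ N mod d → N ≡ᴹ M mod d
  ≡ᴹmod-sym (entrywise a b c e) = entrywise (≡mod-sym a) (≡mod-sym b) (≡mod-sym c) (≡mod-sym e)

  ≡ᴹmod-trans : ∀ {L M N} → L ≡ᴹ M mod d → M ≡ᴹ N mod d → L ≡ᴹ N mod d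
  ≡ᴹmod-trans (entrywise a b c e) (entrywise a' b' c' e') =
    entrywise (≡mod-trans a a') (≡mod-trans b b') (≡mod-trans c c') (≡mod-trans e e')

  ·ᶻ-cong-mod : ∀ {M M' N N'} → M ≡ᴹ M' mod d → N ≡ᴹ N' mod d → M ·ᶻ N ≡ᴹ M' ·ᶻ N' mod d
  ·ᶻ-cong-mod (entrywise a b c e) (entrywise a' b' c' e') = entrywise
    (+-cong-mod (*-cong-mod a a') (*-cong-mod b c')) (+-cong-mod (*-cong-mod a b') (*-cong-mod b e'))
    (+-cong-mod (*-cong-mod c a') (*-cong-mod e c')) (+-cong-mod (*-cong-mod c b') (*-cong-mod e e'))

  ⊕ᶻ-cong-mod : ∀ {M M' N N'} → M ≡ᴹ M' mod d → N ≡ᴹ N' mod d → M ⊕ᶻ N ≡ᴹ M' ⊕ᶻ N' mod d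
  ⊕ᶻ-cong-mod (entrywise a b c e) (entrywise a' b' c' e') =
    entrywise (+-cong-mod a a') (+-cong-mod b b') (+-cong-mod c c') (+-cong-mod e e')

⟦⟧-cong : ∀ {a b c e a' b' c' e'} → a ≡ a' → b ≡ b' → c ≡ c' → e ≡ e' →
          ⟦ a , b , c , e ⟧ ≡ ⟦ a' , b' , c' , e' ⟧
⟦⟧-cong refl refl refl refl = refl

·ᶻ-assoc : ∀ L M N → (L ·ᶻ M) ·ᶻ N ≡ L ·ᶻ (M ·ᶻ N)
·ᶻ-assoc ⟦ a , b , c , e ⟧ ⟦ a' , b' , c' , e' ⟧ ⟦ a'' , b'' , c'' , e'' ⟧ =
  ⟦⟧-cong (solve xs) (solve xs) (solve xs) (solve xs)
  where xs = a ∷ b ∷ c ∷ e ∷ a' ∷ b' ∷ c' ∷ e' ∷ a'' ∷ b'' ∷ c'' ∷ e'' ∷ []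

·ᶻ-identityʳ : ∀ M → M ·ᶻ 𝟙ᶻ ≡ M
·ᶻ-identityʳ ⟦ a , b , c , e ⟧ = ⟦⟧-cong (solve xs) (solve xs) (solve xs) (solve xs)
  where xs = a ∷ b ∷ c ∷ e ∷ []

·ᶻ-distribʳ-⊕ᶻ⋆ᶻ : ∀ s M N L → (M ⊕ᶻ s ⋆ᶻ N) ·ᶻ L ≡ M ·ᶻ L ⊕ᶻ s ⋆ᶻ (N ·ᶻ L)
·ᶻ-distribʳ-⊕ᶻ⋆ᶻ s ⟦ a , b , c , e ⟧ ⟦ a' , b' , c' , e' ⟧ ⟦ a'' , b'' , c'' , e'' ⟧ =
  ⟦⟧-cong (solve xs) (solve xs) (solve xs) (solve xs)
  where xs = s ∷ a ∷ b ∷ c ∷ e ∷ a' ∷ b' ∷ c' ∷ e' ∷ a'' ∷ b'' ∷ c'' ∷ e'' ∷ []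

·ᶻ-neg-commute : ∀ M N → M ·ᶻ (-𝟙ᶻ ·ᶻ N) ≡ -𝟙ᶻ ·ᶻ (M ·ᶻ N)
·ᶻ-neg-commute ⟦ a , b , c , e ⟧ ⟦ a' , b' , c' , e' ⟧ = ⟦⟧-cong (solve xs) (solve xs) (solve xs) (solve xs)
  where xs = a ∷ b ∷ c ∷ e ∷ a' ∷ b' ∷ c' ∷ e' ∷ []

neg-·ᶻ-neg : ∀ M N → (-𝟙ᶻ ·ᶻ M) ·ᶻ (-𝟙ᶻ ·ᶻ N) ≡ M ·ᶻ N
neg-·ᶻ-neg ⟦ a , b , c , e ⟧ ⟦ a' , b' , c' , e' ⟧ = ⟦⟧-cong (solve xs) (solve xs) (solve xs) (solve xs)
  where xs = a ∷ b ∷ c ∷ e ∷ a' ∷ b' ∷ c' ∷ e' ∷ []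

⋆ᶻ-assoc : ∀ s t M → (s * t) ⋆ᶻ M ≡ s ⋆ᶻ (t ⋆ᶻ M)
⋆ᶻ-assoc s t ⟦ a , b , c , e ⟧ = ⟦⟧-cong (solve xs) (solve xs) (solve xs) (solve xs)
  where xs = s ∷ t ∷ a ∷ b ∷ c ∷ e ∷ []

binomial : ∀ s M → (𝟙ᶻ ⊕ᶻ s ⋆ᶻ M) ·ᶻ (𝟙ᶻ ⊕ᶻ s ⋆ᶻ M) ≡ 𝟙ᶻ ⊕ᶻ (s + s) ⋆ᶻ M ⊕ᶻ (s * s) ⋆ᶻ (M ·ᶻ M)
binomial s ⟦ a , b , c , e ⟧ = ⟦⟧-cong (solve xs) (solve xs) (solve xs) (solve xs)
  where xs = s ∷ a ∷ b ∷ c ∷ e ∷ []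

square-rootᶻ : ∀ s q r u v M → s + s ≡ q + r * u → s * s ≡ r * v →
  𝟙ᶻ ⊕ᶻ q ⋆ᶻ M ≡ (𝟙ᶻ ⊕ᶻ s ⋆ᶻ M) ·ᶻ (𝟙ᶻ ⊕ᶻ s ⋆ᶻ M) ⊕ᶻ r ⋆ᶻ (- 1ℤ ⋆ᶻ (u ⋆ᶻ M ⊕ᶻ v ⋆ᶻ (M ·ᶻ M)))
square-rootᶻ s q r u v M 2s≡ s²≡ = begin
  𝟙ᶻ ⊕ᶻ q ⋆ᶻ M
    ≡⟨ regroup M ⟩
  𝟙ᶻ ⊕ᶻ (q + r * u) ⋆ᶻ M ⊕ᶻ (r * v) ⋆ᶻ (M ·ᶻ M) ⊕ᶻ r ⋆ᶻ N
    ≡⟨ cong₂ (λ a b → 𝟙ᶻ ⊕ᶻ a ⋆ᶻ M ⊕ᶻ b ⋆ᶻ (M ·ᶻ M) ⊕ᶻ r ⋆ᶻ N) 2s≡ s²≡ ⟨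
  𝟙ᶻ ⊕ᶻ (s + s) ⋆ᶻ M ⊕ᶻ (s * s) ⋆ᶻ (M ·ᶻ M) ⊕ᶻ r ⋆ᶻ N
    ≡⟨ cong (_⊕ᶻ r ⋆ᶻ N) (binomial s M) ⟨
  (𝟙ᶻ ⊕ᶻ s ⋆ᶻ M) ·ᶻ (𝟙ᶻ ⊕ᶻ s ⋆ᶻ M) ⊕ᶻ r ⋆ᶻ N
    ∎
  where
  open ≡-Reasoning
  N : M₂ℤ
  N = - 1ℤ ⋆ᶻ (u ⋆ᶻ M ⊕ᶻ v ⋆ᶻ (M ·ᶻ M))
  regroup : ∀ L → 𝟙ᶻ ⊕ᶻ q ⋆ᶻ L ≡
    𝟙ᶻ ⊕ᶻ (q + r * u) ⋆ᶻ L ⊕ᶻ (r * v) ⋆ᶻ (L ·ᶻ L) ⊕ᶻ r ⋆ᶻ (- 1ℤ ⋆ᶻ (u ⋆ᶻ L ⊕ᶻ v ⋆ᶻ (L ·ᶻ L)))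
  regroup ⟦ a , b , c , e ⟧ = ⟦⟧-cong (solve xs) (solve xs) (solve xs) (solve xs)
    where xs = q ∷ r ∷ u ∷ v ∷ a ∷ b ∷ c ∷ e ∷ []

-- M₂(ℤ_p) through its finite levels

module _ {p : ℕ} where

  p^_ : ℕ → ℤ
  p^ k = + (p ^ℕ k)

  p^-suc : ∀ k → p^ suc k ≡ p^ k * + p
  p^-suc k = trans (cong +_ (ℕ.*-comm p (p ^ℕ k))) (pos-* (p ^ℕ k) p)

  p^-suc² : ∀ k → p^ suc (suc k) ≡ p^ k * + p * + p
  p^-suc² k = trans (p^-suc (suc k)) (cong (_* + p) (p^-suc k))

  -- _·_, _⊕_, ι c ⋆_, 𝟙 and -𝟙 commute definitionally with _↓_, so an identity of integer
  -- matrices yields the same identity in M₂(ℤ_p) (levelwise-≡⇒≋).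
  infixl 8 _↓_
  _↓_ : M₂ p → ℕ → M₂ℤ
  A ↓ k = ⟦ seq (e₁₁ A) k , seq (e₁₂ A) k , seq (e₂₁ A) k , seq (e₂₂ A) k ⟧

  -- Equivalent to _≈_ (≈⇒≋, ≋⇒≈), which unfolds to a product of functions; being a record,
  -- _≋_ lets Agda infer the matrices it relates.
  infix 4 _≋_
  record _≋_ (A B : M₂ p) : Set where
    constructor levelwise
    field at-level : ∀ k → A ↓ k ≡ᴹ B ↓ k mod p^ k

  ≈⇒≋ : ∀ {A B} → A ≈ B → A ≋ B
  ≈⇒≋ (a , b , c , e) =
    levelwise λ k → entrywise (mod-intro (a k)) (mod-intro (b k)) (mod-intro (c k)) (mod-intro (e k))

  ≋⇒≈ : ∀ {A B} → A ≋ B → A ≈ B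
  ≋⇒≈ (levelwise eq) = (proj₁ ∘ entries ∘ eq) , (proj₁ ∘ proj₂ ∘ entries ∘ eq)
                     , (proj₁ ∘ proj₂ ∘ proj₂ ∘ entries ∘ eq) , (proj₂ ∘ proj₂ ∘ proj₂ ∘ entries ∘ eq)

  ≋-refl : ∀ {A} → A ≋ A
  ≋-refl = levelwise λ _ → ≡⇒≡ᴹmod refl

  ≋-sym : ∀ {A B} → A ≋ B → B ≋ A
  ≋-sym (levelwise eq) = levelwise (≡ᴹmod-sym ∘ eq)

  ≋-trans : ∀ {A B C} → A ≋ B → B ≋ C → A ≋ C
  ≋-trans (levelwise eq) (levelwise eq') = levelwise λ k → ≡ᴹmod-trans (eq k) (eq' k)

  ≋-setoid : Setoid 0ℓ 0ℓ
  ≋-setoid = record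
    { Carrier = M₂ p ; _≈_ = _≋_
    ; isEquivalence = record { refl = ≋-refl ; sym = ≋-sym ; trans = ≋-trans } }

  ≡⇒≋ : ∀ {A B} → A ≡ B → A ≋ B
  ≡⇒≋ refl = ≋-refl

  levelwise-≡⇒≋ : ∀ {A B} → (∀ k → A ↓ k ≡ B ↓ k) → A ≋ B
  levelwise-≡⇒≋ eq = levelwise (≡⇒≡ᴹmod ∘ eq)

  ·-cong : ∀ {A A' B B'} → A ≋ A' → B ≋ B' → A · B ≋ A' · B'
  ·-cong (levelwise eq) (levelwise eq') = levelwise λ k → ·ᶻ-cong-mod (eq k) (eq' k)

  ⊕-cong : ∀ {A A' B B'} → A ≋ A' → B ≋ B' → A ⊕ B ≋ A' ⊕ B'
  ⊕-cong (levelwise eq) (levelwise eq') = levelwise λ k → ⊕ᶻ-cong-mod (eq k) (eq' k)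

  -- The fixed operand is explicit, and elsewhere matrices under _·_ are often passed explicitly:
  -- solving such metavariables by unification unfolds the coherence proofs of ℤ_p and is very slow.
  ·-congʳ : ∀ {A A'} C → A ≋ A' → A · C ≋ A' · C
  ·-congʳ C A≋A' = ·-cong A≋A' (≋-refl {C})

  ·-congˡ : ∀ A {B B'} → B ≋ B' → A · B ≋ A · B'
  ·-congˡ A = ·-cong (≋-refl {A})

  ⊕-congʳ : ∀ {A A'} B → A ≋ A' → A ⊕ B ≋ A' ⊕ B
  ⊕-congʳ B A≋A' = ⊕-cong A≋A' (≋-refl {B})

  ⊕-congˡ : ∀ A {B B'} → B ≋ B' → A ⊕ B ≋ A ⊕ B'
  ⊕-congˡ A = ⊕-cong (≋-refl {A})

  ·-assoc : ∀ A B C → (A · B) · C ≋ A · (B · C)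
  ·-assoc A B C = levelwise-≡⇒≋ λ k → ·ᶻ-assoc (A ↓ k) (B ↓ k) (C ↓ k)

  ·-identityʳ : ∀ A → A · 𝟙 ≋ A
  ·-identityʳ A = levelwise-≡⇒≋ λ k → ·ᶻ-identityʳ (A ↓ k)

  ·-distribʳ-⊕⋆ : ∀ c A B C → (A ⊕ ι c ⋆ B) · C ≋ A · C ⊕ ι c ⋆ (B · C)
  ·-distribʳ-⊕⋆ c A B C = levelwise-≡⇒≋ λ k → ·ᶻ-distribʳ-⊕ᶻ⋆ᶻ c (A ↓ k) (B ↓ k) (C ↓ k)

  ·-neg-commute : ∀ A B → A · (-𝟙 · B) ≋ -𝟙 · (A · B)
  ·-neg-commute A B = levelwise-≡⇒≋ λ k → ·ᶻ-neg-commute (A ↓ k) (B ↓ k)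

  neg-·-neg : ∀ A B → (-𝟙 · A) · (-𝟙 · B) ≋ A · B
  neg-·-neg A B = levelwise-≡⇒≋ λ k → neg-·ᶻ-neg (A ↓ k) (B ↓ k)

  -𝟙·-𝟙≋𝟙 : -𝟙 · -𝟙 ≋ 𝟙
  -𝟙·-𝟙≋𝟙 = levelwise-≡⇒≋ λ _ → refl

  ⋆-assoc : ∀ x y A → ι (x * y) ⋆ A ≋ ι x ⋆ (ι y ⋆ A)
  ⋆-assoc x y A = levelwise-≡⇒≋ λ k → ⋆ᶻ-assoc x y (A ↓ k)

  infix 4 _≡_mod-p^_
  record _≡_mod-p^_ (A B : M₂ p) (k : ℕ) : Set where
    constructor near
    field
      quotient : M₂ p
      split    : A ≋ B ⊕ ι (p^ k) ⋆ quotient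

  NearMod⇒≡mod-p^ : ∀ k A B → NearMod k A B → A ≡ B mod-p^ k
  NearMod⇒≡mod-p^ k A B (Y , A≈B+p^kY) = near Y (≈⇒≋ {A} {B ⊕ ι (p^ k) ⋆ Y} A≈B+p^kY)

  ≡mod-p^⇒NearMod : ∀ k A B → A ≡ B mod-p^ k → NearMod k A B
  ≡mod-p^⇒NearMod k A B (near Y A≋B+p^kY) = Y , ≋⇒≈ {A} {B ⊕ ι (p^ k) ⋆ Y} A≋B+p^kY

  ≡mod-p^-respˡ : ∀ {k A A' B} → A ≋ A' → A ≡ B mod-p^ k → A' ≡ B mod-p^ k
  ≡mod-p^-respˡ A≋A' (near Y split) = near Y (≋-trans (≋-sym A≋A') split)

  ≡mod-p^-respʳ : ∀ {k A B B'} → B ≋ B' → A ≡ B mod-p^ k → A ≡ B' mod-p^ k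
  ≡mod-p^-respʳ {k} B≋B' (near Y split) = near Y (≋-trans split (⊕-congʳ (ι (p^ k) ⋆ Y) B≋B'))

  ≡mod-p^-·ʳ : ∀ {k A B} C → A ≡ B mod-p^ k → A · C ≡ B · C mod-p^ k
  ≡mod-p^-·ʳ {k} {A} {B} C (near Y split) = near (Y · C) (begin
    A · C                         ≈⟨ ·-congʳ C split ⟩
    (B ⊕ ι (p^ k) ⋆ Y) · C        ≈⟨ ·-distribʳ-⊕⋆ (p^ k) B Y C ⟩
    B · C ⊕ ι (p^ k) ⋆ (Y · C)    ∎)
    where open SetoidReasoning ≋-setoid

  ≡mod-p^-suc⇒ : ∀ {k A B} → A ≡ B mod-p^ suc k → A ≡ B mod-p^ k
  ≡mod-p^-suc⇒ {k} {A} {B} (near Y split) = near (ι (+ p) ⋆ Y) (begin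
    A                               ≈⟨ split ⟩
    B ⊕ ι (p^ suc k) ⋆ Y            ≈⟨ ⊕-congˡ B (≡⇒≋ (cong (λ c → ι c ⋆ Y) (p^-suc k))) ⟩
    B ⊕ ι (p^ k * + p) ⋆ Y          ≈⟨ ⊕-congˡ B (⋆-assoc (p^ k) (+ p) Y) ⟩
    B ⊕ ι (p^ k) ⋆ (ι (+ p) ⋆ Y)    ∎)
    where open SetoidReasoning ≋-setoid

  ≡mod-p^-weaken : ∀ {j k A B} → j ≤ k → A ≡ B mod-p^ k → A ≡ B mod-p^ j
  ≡mod-p^-weaken = go ∘ ℕ.≤⇒≤′
    where
    go : ∀ {j k A B} → j ≤′ k → A ≡ B mod-p^ k → A ≡ B mod-p^ j
    go ≤′-refl        A≡B = A≡B
    go (≤′-step j≤′k) A≡B = go j≤′k (≡mod-p^-suc⇒ A≡B)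

  ≡⇒·⁻¹≡𝟙 : ∀ {k A B W} → IsInverse B W → A ≡ B mod-p^ k → A · W ≡ 𝟙 mod-p^ k
  ≡⇒·⁻¹≡𝟙 {B = B} {W} (BW≈𝟙 , _) A≡B =
    ≡mod-p^-respʳ (≈⇒≋ {B · W} {𝟙} BW≈𝟙) (≡mod-p^-·ʳ W A≡B)

  ·⁻¹≡⇒≡ : ∀ {k A B W C} → IsInverse B W → A · W ≡ C mod-p^ k → A ≡ C · B mod-p^ k
  ·⁻¹≡⇒≡ {A = A} {B} {W} (_ , WB≈𝟙) AW≡C = ≡mod-p^-respˡ AWB≋A (≡mod-p^-·ʳ B AW≡C)
    where
    open SetoidReasoning ≋-setoid
    AWB≋A : (A · W) · B ≋ A
    AWB≋A = begin
      (A · W) · B    ≈⟨ ·-assoc A W B ⟩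
      A · (W · B)    ≈⟨ ·-congˡ A {W · B} {𝟙} (≈⇒≋ {W · B} {𝟙} WB≈𝟙) ⟩
      A · 𝟙          ≈⟨ ·-identityʳ A ⟩
      A              ∎

  square-root-mod : ∀ m c u v Y → c + c ≡ p^ m + p^ suc m * u → c * c ≡ p^ suc m * v →
    𝟙 ⊕ ι (p^ m) ⋆ Y ≡ (𝟙 ⊕ ι c ⋆ Y) · (𝟙 ⊕ ι c ⋆ Y) mod-p^ suc m
  square-root-mod m c u v Y 2c≡ c²≡ = near (ι (- 1ℤ) ⋆ (ι u ⋆ Y ⊕ ι v ⋆ (Y · Y)))
    (levelwise-≡⇒≋ λ k → square-rootᶻ c (p^ m) (p^ suc m) u v (Y ↓ k) 2c≡ c²≡)

  𝟙⊕p^⋆≡𝟙 : ∀ j x Y → 𝟙 ⊕ ι (p^ j * x) ⋆ Y ≡ 𝟙 mod-p^ j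
  𝟙⊕p^⋆≡𝟙 j x Y = near (ι x ⋆ Y) (⊕-congˡ 𝟙 (⋆-assoc (p^ j) x Y))

  odd-square-root : ∀ h → + p ≡ h + h - 1ℤ → ∀ m {A} → A ≡ 𝟙 mod-p^ suc m →
    Σ (M₂ p) λ C → C ≡ 𝟙 mod-p^ suc m × A ≡ C · C mod-p^ suc (suc m)
  odd-square-root h p≡2h-1 m (near Y A≋) =
    𝟙 ⊕ ι c ⋆ Y , 𝟙⊕p^⋆≡𝟙 (suc m) h Y ,
    ≡mod-p^-respˡ (≋-sym A≋) (square-root-mod (suc m) c 1ℤ (h * h * r) Y twice-c c²)
    where
    open ≡-Reasoning
    r s c : ℤ
    r = p^ m
    s = + p
    c = p^ suc m * h
    halve : ∀ {y} x → y ≡ h + h - 1ℤ → x * y * h + x * y * h ≡ x * y + x * y * y * 1ℤ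
    halve x refl = solve (x ∷ h ∷ [])
    regroup : ∀ x y z → x * y * z * (x * y * z) ≡ x * y * y * (z * z * x)
    regroup = solve-∀
    twice-c : c + c ≡ p^ suc m + p^ suc (suc m) * 1ℤ
    twice-c = begin
      c + c                            ≡⟨ cong (λ x → x * h + x * h) (p^-suc m) ⟩
      r * s * h + r * s * h            ≡⟨ halve r p≡2h-1 ⟩
      r * s + r * s * s * 1ℤ           ≡⟨ cong₂ (λ a b → a + b * 1ℤ) (p^-suc m) (p^-suc² m) ⟨
      p^ suc m + p^ suc (suc m) * 1ℤ   ∎
    c² : c * c ≡ p^ suc (suc m) * (h * h * r)
    c² = begin
      c * c                            ≡⟨ cong (λ x → x * h * (x * h)) (p^-suc m) ⟩
      r * s * h * (r * s * h)          ≡⟨ regroup r s h ⟩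
      r * s * s * (h * h * r)          ≡⟨ cong (_* (h * h * r)) (p^-suc² m) ⟨
      p^ suc (suc m) * (h * h * r)     ∎

  even-square-root : p ≡ 2 → ∀ t {A} → A ≡ 𝟙 mod-p^ (3 +ℕ t) →
    Σ (M₂ p) λ C → C ≡ 𝟙 mod-p^ (2 +ℕ t) × A ≡ C · C mod-p^ (4 +ℕ t)
  even-square-root p≡2 t (near Y A≋) =
    𝟙 ⊕ ι c ⋆ Y , 𝟙⊕p^⋆≡𝟙 (2 +ℕ t) 1ℤ Y ,
    ≡mod-p^-respˡ (≋-sym A≋) (square-root-mod (3 +ℕ t) c 0ℤ r Y twice-c c²)
    where
    open ≡-Reasoning
    r s q c : ℤ
    r = p^ t
    s = + p
    q = p^ (2 +ℕ t)
    c = q * 1ℤ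
    double : ∀ {y} x → y ≡ + 2 → x * 1ℤ + x * 1ℤ ≡ x * y + x * y * y * 0ℤ
    double x refl = solve (x ∷ [])
    regroup : ∀ x y z → x * 1ℤ * (y * z * z * 1ℤ) ≡ x * z * z * y
    regroup = solve-∀
    twice-c : c + c ≡ p^ (3 +ℕ t) + p^ (4 +ℕ t) * 0ℤ
    twice-c = begin
      c + c                            ≡⟨ double q (cong +_ p≡2) ⟩
      q * s + q * s * s * 0ℤ           ≡⟨ cong₂ (λ a b → a + b * 0ℤ) (p^-suc (2 +ℕ t)) (p^-suc² (2 +ℕ t)) ⟨
      p^ (3 +ℕ t) + p^ (4 +ℕ t) * 0ℤ   ∎
    c² : c * c ≡ p^ (4 +ℕ t) * r
    c² = begin
      c * c                            ≡⟨ cong (λ x → c * (x * 1ℤ)) (p^-suc² t) ⟩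
      q * 1ℤ * (r * s * s * 1ℤ)        ≡⟨ regroup q r s ⟩
      q * s * s * r                    ≡⟨ cong (_* r) (p^-suc² (2 +ℕ t)) ⟨
      p^ (4 +ℕ t) * r                  ∎

  -- Subgroups of GL₂(ℤ_p) and the layers 1 + p^m M₂(ℤ_p)

  module _ {H : M₂ p → Set} (H-subgroup : IsSubgroupGL₂ H) where

    open IsSubgroupGL₂ H-subgroup

    respects-≋ : ∀ {A B} → A ≋ B → H A → H B
    respects-≋ {A} {B} A≋B = respects {A} {B} (≋⇒≈ A≋B)

    ±H : M₂ p → Set
    ±H A = H A ⊎ H (-𝟙 · A)

    ±H-neg : ±H -𝟙
    ±H-neg = inj₂ (respects-≋ (≋-sym -𝟙·-𝟙≋𝟙) one)

    ±H-mul : ∀ {A B} → ±H A → ±H B → ±H (A · B)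
    ±H-mul         (inj₁ a) (inj₁ b) = inj₁ (mul a b)
    ±H-mul {A} {B} (inj₁ a) (inj₂ b) = inj₂ (respects-≋ (·-neg-commute A B) (mul a b))
    ±H-mul {A} {B} (inj₂ a) (inj₁ b) = inj₂ (respects-≋ (·-assoc -𝟙 A B) (mul a b))
    ±H-mul {A} {B} (inj₂ a) (inj₂ b) = inj₁ (respects-≋ (neg-·-neg A B) (mul a b))

    neg-inverse : ∀ {A B : M₂ p} → IsInverse A B → IsInverse (-𝟙 · A) (-𝟙 · B)
    neg-inverse {A} {B} (AB≈𝟙 , BA≈𝟙) =
      ≋⇒≈ {(-𝟙 · A) · (-𝟙 · B)} {𝟙} (≋-trans (neg-·-neg A B) (≈⇒≋ {A · B} {𝟙} AB≈𝟙)) ,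
      ≋⇒≈ {(-𝟙 · B) · (-𝟙 · A)} {𝟙} (≋-trans (neg-·-neg B A) (≈⇒≋ {B · A} {𝟙} BA≈𝟙))

    ±H-inv : ∀ {A B} → ±H A → IsInverse A B → ±H B
    ±H-inv {A} {B} (inj₁ a) A⁻¹ = inj₁ (inv {A} {B} a A⁻¹)
    ±H-inv {A} {B} (inj₂ a) A⁻¹ = inj₂ (inv { -𝟙 · A } { -𝟙 · B } a (neg-inverse {A} {B} A⁻¹))

    ±H-resp : ∀ {A B} → A ≈ B → ±H A → ±H B
    ±H-resp {A} {B} A≈B (inj₁ a) = inj₁ (respects {A} {B} A≈B a)
    ±H-resp {A} {B} A≈B (inj₂ a) = inj₂ (respects-≋ (·-congˡ -𝟙 (≈⇒≋ {A} {B} A≈B)) a)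

    generated⊆±H : ∀ {A} → Gen H A → ±H A
    generated⊆±H (gen-H a)        = inj₁ a
    generated⊆±H gen-neg          = ±H-neg
    generated⊆±H (gen-mul a b)    = ±H-mul (generated⊆±H a) (generated⊆±H b)
    generated⊆±H (gen-inv a A⁻¹)  = ±H-inv (generated⊆±H a) A⁻¹
    generated⊆±H (gen-resp A≈B a) = ±H-resp A≈B (generated⊆±H a)

    ±H⇒square∈H : ∀ {A} → ±H A → H (A · A)
    ±H⇒square∈H     (inj₁ a) = mul a a
    ±H⇒square∈H {A} (inj₂ a) = respects-≋ (neg-·-neg A A) (mul a a)

    ±H⇒invertible : ∀ {A} → ±H A → InGL₂ A
    ±H⇒invertible (inj₁ a) = inGL a
    ±H⇒invertible {A} (inj₂ a) with inGL a
    ... | B , -AB≈𝟙 , B-A≈𝟙 =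
      -𝟙 · B , ≋⇒≈ {A · (-𝟙 · B)} {𝟙} right , ≋⇒≈ {(-𝟙 · B) · A} {𝟙} left
      where
      open SetoidReasoning ≋-setoid
      right : A · (-𝟙 · B) ≋ 𝟙
      right = begin
        A · (-𝟙 · B)    ≈⟨ ·-neg-commute A B ⟩
        -𝟙 · (A · B)    ≈⟨ ·-assoc -𝟙 A B ⟨
        (-𝟙 · A) · B    ≈⟨ ≈⇒≋ {(-𝟙 · A) · B} {𝟙} -AB≈𝟙 ⟩
        𝟙               ∎
      left : (-𝟙 · B) · A ≋ 𝟙
      left = begin
        (-𝟙 · B) · A    ≈⟨ ·-assoc -𝟙 B A ⟩
        -𝟙 · (B · A)    ≈⟨ ·-neg-commute B A ⟨
        B · (-𝟙 · A)    ≈⟨ ≈⇒≋ {B · (-𝟙 · A)} {𝟙} B-A≈𝟙 ⟩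
        𝟙               ∎

    generated⇒invertible : ∀ {A} → Gen H A → InGL₂ A
    generated⇒invertible = ±H⇒invertible ∘ generated⊆±H

    generated-square∈H : ∀ {n} → (∀ A → Cong n A → Gen H A) →
      ∀ {j} → n ≤ j → ∀ {C} → C ≡ 𝟙 mod-p^ j → H (C · C)
    generated-square∈H {n} gen n≤j {C} C≡𝟙 =
      ±H⇒square∈H (generated⊆±H (gen C (≡mod-p^⇒NearMod n C 𝟙 (≡mod-p^-weaken n≤j C≡𝟙))))

    CongruentToH : ℕ → M₂ p → Set
    CongruentToH k A = Σ (M₂ p) λ B → H B × A ≡ B mod-p^ k

    SurjectiveOnLayersFrom : ℕ → Set
    SurjectiveOnLayersFrom m₀ = ∀ m → m₀ ≤ m → ∀ {A} → A ≡ 𝟙 mod-p^ m → CongruentToH (suc m) A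

    surjective⇒congruentToH : ∀ {m₀} → SurjectiveOnLayersFrom m₀ →
      ∀ d {m} → m₀ ≤ m → ∀ {A} → A ≡ 𝟙 mod-p^ m → CongruentToH (d +ℕ m) A
    surjective⇒congruentToH surj zero    m₀≤m A≡𝟙 = 𝟙 , one , A≡𝟙
    surjective⇒congruentToH surj (suc d) {m} m₀≤m {A} A≡𝟙 =
      let B , b , A≡B = surj m m₀≤m A≡𝟙
          W , B⁻¹ = inGL b
          B' , b' , AW≡B' = surjective⇒congruentToH surj d (ℕ.m≤n⇒m≤1+n m₀≤m)
                              (≡⇒·⁻¹≡𝟙 {suc m} {A} {B} {W} B⁻¹ A≡B)
      in B' · B , mul b' b ,
         subst (λ k → A ≡ B' · B mod-p^ k) (ℕ.+-suc d m) (·⁻¹≡⇒≡ {d +ℕ suc m} {A} {B} {W} {B'} B⁻¹ AW≡B')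

    closed-⊇-layer : IsClosed H → ∀ {m₀} → SurjectiveOnLayersFrom m₀ →
      ∀ {A} → InGL₂ A → A ≡ 𝟙 mod-p^ m₀ → H A
    closed-⊇-layer closed {m₀} surj {A} A-invertible A≡𝟙 = closed A A-invertible λ k →
      let B , b , A≡B = surjective⇒congruentToH surj k ℕ.≤-refl A≡𝟙
      in B , b , ≡mod-p^⇒NearMod k A B (≡mod-p^-weaken {k} {k +ℕ m₀} {A} {B} (ℕ.m≤m+n k m₀) A≡B)

    odd-surjective : ∀ {n} → (∀ A → Cong n A → Gen H A) →
      ∀ h → + p ≡ h + h - 1ℤ → 1 ≤ n → SurjectiveOnLayersFrom n
    odd-surjective gen h p≡2h-1 (s≤s _) zero ()
    odd-surjective gen h p≡2h-1 1≤n (suc m) n≤1+m A≡𝟙 =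
      let C , C≡𝟙 , A≡C² = odd-square-root h p≡2h-1 m A≡𝟙
      in C · C , generated-square∈H gen n≤1+m C≡𝟙 , A≡C²

    even-surjective : ∀ {n} → (∀ A → Cong n A → Gen H A) →
      p ≡ 2 → 2 ≤ n → SurjectiveOnLayersFrom (suc n)
    even-surjective gen p≡2 (s≤s (s≤s z≤n)) (suc (suc zero)) (s≤s (s≤s ()))
    even-surjective gen p≡2 (s≤s (s≤s z≤n)) (suc (suc (suc t))) (s≤s n≤2+t) A≡𝟙 =
      let C , C≡𝟙 , A≡C² = even-square-root p≡2 t A≡𝟙
      in C · C , generated-square∈H gen n≤2+t C≡𝟙 , A≡C²

odd-prime≡2h-1 : ∀ {p} → Prime p → 3 ≤ p → Σ ℤ λ h → + p ≡ h + h - 1ℤ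
odd-prime≡2h-1 {p} p-prime 3≤p with p % 2 | m≡m%n+[m/n]*n p 2 | m%n<n p 2
... | 0 | p≡q*2 | _ = ⊥-elim (Prime.notComposite p-prime
      (composite-≢ 2 {{_}} {{prime⇒nonZero p-prime}} (ℕ.<⇒≢ 3≤p) (divides (p / 2) p≡q*2)))
... | 1 | p≡1+q*2 | _ = + q + 1ℤ , (begin
  + p                           ≡⟨ cong +_ p≡1+q*2 ⟩
  + (1 +ℕ q *ℕ 2)               ≡⟨ pos-+ 1 (q *ℕ 2) ⟩
  1ℤ + + (q *ℕ 2)               ≡⟨ cong (λ x → 1ℤ + x) (pos-* q 2) ⟩
  1ℤ + + q * + 2                ≡⟨ halve (+ q) ⟩
  (+ q + 1ℤ) + (+ q + 1ℤ) - 1ℤ  ∎)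
  where
  q = p / 2
  open ≡-Reasoning
  halve : ∀ h → 1ℤ + h * + 2 ≡ (h + 1ℤ) + (h + 1ℤ) - 1ℤ
  halve = solve-∀
... | suc (suc _) | _ | s≤s (s≤s ())

corollary2p4 : (p : ℕ) → Prime p → (H : M₂ p → Set) → IsClosedSubgroupGL₂ H →
    (n : ℕ) → 1 ≤ n → (∀ A → Cong n A → Gen H A) →
    ((3 ≤ p → ∀ A → Cong n A → H A) ×
     (p ≡ 2 → 2 ≤ n → ∀ A → Cong (suc n) A → H A))
corollary2p4 p p-prime H H-closed n 1≤n gen = odd , even
  where
  open IsClosedSubgroupGL₂ H-closed
  odd : 3 ≤ p → ∀ A → Cong n A → H A
  odd 3≤p A A∈ =
    let h , p≡2h-1 = odd-prime≡2h-1 p-prime 3≤p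
    in closed-⊇-layer subgroup closed (odd-surjective subgroup gen h p≡2h-1 1≤n)
         (generated⇒invertible subgroup (gen A A∈)) (NearMod⇒≡mod-p^ n A 𝟙 A∈)
  even : p ≡ 2 → 2 ≤ n → ∀ A → Cong (suc n) A → H A
  even p≡2 2≤n A A∈ =
    let A≡𝟙 = NearMod⇒≡mod-p^ (suc n) A 𝟙 A∈
    in closed-⊇-layer subgroup closed (even-surjective subgroup gen p≡2 2≤n)
         (generated⇒invertible subgroup (gen A (≡mod-p^⇒NearMod n A 𝟙 (≡mod-p^-suc⇒ A≡𝟙)))) A≡𝟙
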